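{- In multi-sorted classical first-order logic extended with equivalence atomic formulas $\vec{x}\sim\vec{y}$ and conditional independence atomic formulas $\vec{x}\perp\vec{y}\mid\vec{z}$, every instance of the schema $$(\exists\vec{y}.\ \Phi(\vec{x},\vec{y},\vec{w}))\ \to\ \forall\vec{z}.\ \big(\vec{x}\perp\vec{z}\mid\vec{w}\ \to\ \exists\vec{y}.\ (\vec{x},\vec{y}\perp\vec{z}\mid\vec{w}\ \wedge\ \Phi(\vec{x},\vec{y},\vec{w}))\big)$$ is derivable from the axiom schemas (E1)–(E7) and (I1)–(I7) listed below. Here $\Phi(\vec{x},\vec{y},\vec{w})$ denotes a formula in which every free variable has been substituted by one of the variables in the lists $\vec{x},\vec{y},\vec{w}$.
   Context: Variables have sorts; $\vec{x}$ etc. denote finite lists of variables, with lengths/sorts matching so that formulas are well formed; for lists $\vec{x}_1,\dots,\vec{x}_n$ and $\vec{y}_1,\dots$, the formula $\vec{x}\sim\vec{y}$ requires identical sort lists, and $\vec{x},\vec{y}$ denotes concatenation. Axiom schemas (universally closed): (E1) $\vec{x}\sim\vec{x}$; (E2) $\vec{x}\sim\vec{y}\to\vec{y}\sim\vec{x}$; (E3) $\vec{x}\sim\vec{y}\wedge\vec{y}\sim\vec{z}\to\vec{x}\sim\vec{z}$; (E4) $\vec{x}\sim\vec{y}\to\pi(\vec{x})\sim\pi(\vec{y})$ for any permutation $\pi$ applied to both lists; (E5) $\vec{x},x\sim\vec{y},y\to\vec{x}\sim\vec{y}$; (E6) (invariance) $\vec{x}\sim\vec{y}\wedge\Phi(\vec{x})\to\Phi(\vec{y})$,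 where all free variables of $\Phi$ lie in a list $\vec{z}$ of distinct variables matching $\vec{x}$ in length and sorts, and $\Phi(\vec{x})$, $\Phi(\vec{y})$ are the substitutions of $\vec{x}$, $\vec{y}$ for $\vec{z}$; (E7) (transfer) $\vec{x}\sim\vec{x}'\to\exists y'.\ \vec{x},y\sim\vec{x}',y'$. (I1) $\vec{x}\perp\vec{y}\mid\vec{z}\to\pi(\vec{x})\perp\pi'(\vec{y})\mid\pi''(\vec{z})$ for permutations $\pi,\pi',\pi''$ of the respective lists; (I2) $\vec{x}\perp\vec{y}\mid\vec{y}$; (I3) $\vec{x}\perp\vec{y}\mid\vec{z}\to\vec{y}\perp\vec{x}\mid\vec{z}$; (I4) $\vec{x}\perp\vec{y},\vec{z}\mid\vec{w}\to\vec{x}\perp\vec{y}\mid\vec{w}$; (I5) $\vec{x}\perp\vec{y},\vec{z}\mid\vec{w}\to\vec{x}\perp\vec{y}\mid\vec{z},\vec{w}$; (I6) $\vec{x}\perp\vec{y}\mid\vec{z},\vec{w}\wedge\vec{x}\perp\vec{z}\mid\vec{w}\to\vec{x}\perp\vec{y},\vec{z}\mid\vec{w}$; (I7) (independence principle) $\exists\vec{y}.\ \vec{y},\vec{w}\sim\vec{x},\vec{w}\wedge\vec{y}\perp\vec{z}\mid\vec{w}$ (with $\vec{y}$ fresh, of the same sorts as $\vec{x}$). -}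

module Defs where

open import Data.List using (List; []; _∷_; _++_; map)
open import Data.List.Relation.Unary.All as All using (All; []; _∷_)
open import Data.List.Relation.Binary.Permutation.Propositional using (_↭_)
open import Data.List.Relation.Binary.Permutation.Propositional.Properties using (All-resp-↭)
open import Data.List.Membership.Propositional using (_∈_)

record Signature : Set₁ where
  field
    Sort  : Set
    Rel   : Set
    arity : Rel → List Sort

module Logic (S : Signature) where
  open Signature S

  infix 4 _∋_
  data _∋_ : List Sort → Sort → Set where
    here  : ∀ {s Γ} → (s ∷ Γ) ∋ s
    there : ∀ {s t Γ} → Γ ∋ s → (t ∷ Γ) ∋ s

  Ren : List Sort → List Sort → Set
  Ren Γ Δ = ∀ {s} → Γ ∋ s → Δ ∋ s

  Vars : List Sort → List Sort → Set
  Vars Γ ss = All (Γ ∋_) ss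

  infixr 5 _++ᵥ_
  _++ᵥ_ : ∀ {Γ ss ts} → Vars Γ ss → Vars Γ ts → Vars Γ (ss ++ ts)
  [] ++ᵥ ys = ys
  (x ∷ xs) ++ᵥ ys = x ∷ (xs ++ᵥ ys)

  lookupV : ∀ {Γ ss s} → Vars Γ ss → ss ∋ s → Γ ∋ s
  lookupV (v ∷ _) here = v
  lookupV (_ ∷ vs) (there i) = lookupV vs i

  renV : ∀ {Γ Δ ss} → Ren Γ Δ → Vars Γ ss → Vars Δ ss
  renV ρ = All.map ρ

  perm : ∀ {Γ ss ss'} → ss ↭ ss' → Vars Γ ss → Vars Γ ss'
  perm p xs = All-resp-↭ p xs

  lift : ∀ {Γ Δ s} → Ren Γ Δ → Ren (s ∷ Γ) (s ∷ Δ)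
  lift ρ here = here
  lift ρ (there v) = there (ρ v)

  infixr 6 _∧'_
  infixr 5 _∨'_
  infixr 4 _⇒_
  data Fm (Γ : List Sort) : Set where
    rel  : (R : Rel) → Vars Γ (arity R) → Fm Γ
    eq   : ∀ {s} → Γ ∋ s → Γ ∋ s → Fm Γ
    sim  : ∀ {ss} → Vars Γ ss → Vars Γ ss → Fm Γ
    -- conditional independence atom  x⃗ ⊥ y⃗ ∣ z⃗
    ind  : ∀ {sx sy sz} → Vars Γ sx → Vars Γ sy → Vars Γ sz → Fm Γ
    ⊥'   : Fm Γ
    _⇒_  : Fm Γ → Fm Γ → Fm Γ
    _∧'_ : Fm Γ → Fm Γ → Fm Γ
    _∨'_ : Fm Γ → Fm Γ → Fm Γ
    ∀'   : (s : Sort) → Fm (s ∷ Γ) → Fm Γ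
    ∃'   : (s : Sort) → Fm (s ∷ Γ) → Fm Γ

  ren : ∀ {Γ Δ} → Ren Γ Δ → Fm Γ → Fm Δ
  ren ρ (rel R xs) = rel R (renV ρ xs)
  ren ρ (eq u v) = eq (ρ u) (ρ v)
  ren ρ (sim xs ys) = sim (renV ρ xs) (renV ρ ys)
  ren ρ (ind xs ys zs) = ind (renV ρ xs) (renV ρ ys) (renV ρ zs)
  ren ρ ⊥' = ⊥'
  ren ρ (φ ⇒ ψ) = ren ρ φ ⇒ ren ρ ψ
  ren ρ (φ ∧' ψ) = ren ρ φ ∧' ren ρ ψ
  ren ρ (φ ∨' ψ) = ren ρ φ ∨' ren ρ ψ
  ren ρ (∀' s φ) = ∀' s (ren (lift ρ) φ)
  ren ρ (∃' s φ) = ∃' s (ren (lift ρ) φ)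

  wk : ∀ {Γ s} → Fm Γ → Fm (s ∷ Γ)
  wk = ren there

  inst : ∀ {Γ s} → Γ ∋ s → Ren (s ∷ Γ) Γ
  inst v here = v
  inst v (there u) = u

  inr : ∀ {Γ} Δ → Ren Γ (Δ ++ Γ)
  inr [] v = v
  inr (s ∷ Δ) v = there (inr Δ v)

  firstVars : ∀ {Γ} Δ → Vars (Δ ++ Γ) Δ
  firstVars [] = []
  firstVars (s ∷ Δ) = here ∷ renV there (firstVars Δ)

  ∃* : ∀ {Γ} ss → Fm (ss ++ Γ) → Fm Γ
  ∃* [] φ = φ
  ∃* (s ∷ ss) φ = ∃* ss (∃' s φ)

  ∀* : ∀ {Γ} ss → Fm (ss ++ Γ) → Fm Γ
  ∀* [] φ = φ
  ∀* (s ∷ ss) φ = ∀* ss (∀' s φ)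

  -- Instances (open; the schemas are universally closed, which amounts to
  -- allowing arbitrary variables of the ambient context) of (E1)-(E7), (I1)-(I7).
  data Axiom (Γ : List Sort) : Fm Γ → Set where
    E1 : ∀ {ss} (x : Vars Γ ss) → Axiom Γ (sim x x)
    E2 : ∀ {ss} (x y : Vars Γ ss) → Axiom Γ (sim x y ⇒ sim y x)
    E3 : ∀ {ss} (x y z : Vars Γ ss) → Axiom Γ (sim x y ∧' sim y z ⇒ sim x z)
    E4 : ∀ {ss ss'} (π : ss ↭ ss') (x y : Vars Γ ss) →
         Axiom Γ (sim x y ⇒ sim (perm π x) (perm π y))
    E5 : ∀ {ss s} (x y : Vars Γ ss) (u v : Γ ∋ s) →
         Axiom Γ (sim (x ++ᵥ (u ∷ [])) (y ++ᵥ (v ∷ [])) ⇒ sim x y)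
    -- Φ has free variables among the distinct variables z⃗ (here: the context ss),
    -- Φ(x⃗) is the substitution of x⃗ for z⃗.
    E6 : ∀ {ss} (x y : Vars Γ ss) (Φ : Fm ss) →
         Axiom Γ (sim x y ∧' ren (lookupV x) Φ ⇒ ren (lookupV y) Φ)
    E7 : ∀ {ss s} (x x' : Vars Γ ss) (y : Γ ∋ s) →
         Axiom Γ (sim x x' ⇒ ∃' s (sim (renV there x ++ᵥ (there y ∷ []))
                                        (renV there x' ++ᵥ (here ∷ []))))
    I1 : ∀ {sx sy sz sx' sy' sz'} (π : sx ↭ sx') (π' : sy ↭ sy') (π'' : sz ↭ sz')
         (x : Vars Γ sx) (y : Vars Γ sy) (z : Vars Γ sz) →
         Axiom Γ (ind x y z ⇒ ind (perm π x) (perm π' y) (perm π'' z))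
    I2 : ∀ {sx sy} (x : Vars Γ sx) (y : Vars Γ sy) → Axiom Γ (ind x y y)
    I3 : ∀ {sx sy sz} (x : Vars Γ sx) (y : Vars Γ sy) (z : Vars Γ sz) →
         Axiom Γ (ind x y z ⇒ ind y x z)
    I4 : ∀ {sx sy sz sw} (x : Vars Γ sx) (y : Vars Γ sy) (z : Vars Γ sz) (w : Vars Γ sw) →
         Axiom Γ (ind x (y ++ᵥ z) w ⇒ ind x y w)
    I5 : ∀ {sx sy sz sw} (x : Vars Γ sx) (y : Vars Γ sy) (z : Vars Γ sz) (w : Vars Γ sw) →
         Axiom Γ (ind x (y ++ᵥ z) w ⇒ ind x y (z ++ᵥ w))
    I6 : ∀ {sx sy sz sw} (x : Vars Γ sx) (y : Vars Γ sy) (z : Vars Γ sz) (w : Vars Γ sw) →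
         Axiom Γ (ind x y (z ++ᵥ w) ∧' ind x z w ⇒ ind x (y ++ᵥ z) w)
    I7 : ∀ {sx sz sw} (x : Vars Γ sx) (z : Vars Γ sz) (w : Vars Γ sw) →
         Axiom Γ (∃* sx (sim (firstVars sx ++ᵥ renV (inr sx) w)
                             (renV (inr sx) x ++ᵥ renV (inr sx) w)
                         ∧' ind (firstVars sx) (renV (inr sx) z) (renV (inr sx) w)))

  infix 2 _⨾_⊢_
  data _⨾_⊢_ (Γ : List Sort) (Δ : List (Fm Γ)) : Fm Γ → Set where
    hyp  : ∀ {φ} → φ ∈ Δ → Γ ⨾ Δ ⊢ φ
    ax   : ∀ {φ} → Axiom Γ φ → Γ ⨾ Δ ⊢ φ
    raa  : ∀ {φ} → Γ ⨾ (φ ⇒ ⊥') ∷ Δ ⊢ ⊥' → Γ ⨾ Δ ⊢ φ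
    ⇒I   : ∀ {φ ψ} → Γ ⨾ φ ∷ Δ ⊢ ψ → Γ ⨾ Δ ⊢ φ ⇒ ψ
    ⇒E   : ∀ {φ ψ} → Γ ⨾ Δ ⊢ φ ⇒ ψ → Γ ⨾ Δ ⊢ φ → Γ ⨾ Δ ⊢ ψ
    ∧I   : ∀ {φ ψ} → Γ ⨾ Δ ⊢ φ → Γ ⨾ Δ ⊢ ψ → Γ ⨾ Δ ⊢ φ ∧' ψ
    ∧E₁  : ∀ {φ ψ} → Γ ⨾ Δ ⊢ φ ∧' ψ → Γ ⨾ Δ ⊢ φ
    ∧E₂  : ∀ {φ ψ} → Γ ⨾ Δ ⊢ φ ∧' ψ → Γ ⨾ Δ ⊢ ψ
    ∨I₁  : ∀ {φ ψ} → Γ ⨾ Δ ⊢ φ → Γ ⨾ Δ ⊢ φ ∨' ψ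
    ∨I₂  : ∀ {φ ψ} → Γ ⨾ Δ ⊢ ψ → Γ ⨾ Δ ⊢ φ ∨' ψ
    ∨E   : ∀ {φ ψ χ} → Γ ⨾ Δ ⊢ φ ∨' ψ → Γ ⨾ φ ∷ Δ ⊢ χ → Γ ⨾ ψ ∷ Δ ⊢ χ → Γ ⨾ Δ ⊢ χ
    ∀I   : ∀ {s φ} → (s ∷ Γ) ⨾ map wk Δ ⊢ φ → Γ ⨾ Δ ⊢ ∀' s φ
    ∀E   : ∀ {s φ} → Γ ⨾ Δ ⊢ ∀' s φ → (v : Γ ∋ s) → Γ ⨾ Δ ⊢ ren (inst v) φ
    ∃I   : ∀ {s φ} (v : Γ ∋ s) → Γ ⨾ Δ ⊢ ren (inst v) φ → Γ ⨾ Δ ⊢ ∃' s φ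
    ∃E   : ∀ {s φ ψ} → Γ ⨾ Δ ⊢ ∃' s φ → (s ∷ Γ) ⨾ φ ∷ map wk Δ ⊢ wk ψ → Γ ⨾ Δ ⊢ ψ
    eqR  : ∀ {s} (v : Γ ∋ s) → Γ ⨾ Δ ⊢ eq v v
    eqS  : ∀ {s φ} {u v : Γ ∋ s} → Γ ⨾ Δ ⊢ eq u v →
           Γ ⨾ Δ ⊢ ren (inst u) φ → Γ ⨾ Δ ⊢ ren (inst v) φ
    -- domains of all sorts are nonempty (standard first-order semantics)
    nonempty : ∀ {s φ} → (s ∷ Γ) ⨾ map wk Δ ⊢ wk φ → Γ ⨾ Δ ⊢ φ

  -- The instance of the schema of Theorem 7.11 determined by x⃗, w⃗ (variables
  -- of Γ), the sort lists of y⃗ and z⃗ (bound), and Φ(x⃗,y⃗,w⃗), given as a formula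
  -- Φ with each free variable mapped by ρ to a position of the list x⃗,y⃗,w⃗.
  schema711 : ∀ {Γ sx sw} (x : Vars Γ sx) (w : Vars Γ sw) (sy sz : List Sort)
              {Θ} (Φ : Fm Θ) (ρ : Ren Θ (sx ++ sy ++ sw)) → Fm Γ
  schema711 {Γ} {sx} {sw} x w sy sz Φ ρ =
    ∃* sy (ΦAt (renV (inr sy) x) (firstVars sy) (renV (inr sy) w))
    ⇒ ∀* sz (ind (renV (inr sz) x) (firstVars sz) (renV (inr sz) w)
             ⇒ ∃* sy (ind (renV (inr sy) (renV (inr sz) x) ++ᵥ firstVars sy)
                          (renV (inr sy) (firstVars sz))
                          (renV (inr sy) (renV (inr sz) w))
                      ∧' ΦAt (renV (inr sy) (renV (inr sz) x)) (firstVars sy)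
                             (renV (inr sy) (renV (inr sz) w))))
    where
    ΦAt : ∀ {Δ} → Vars Δ sx → Vars Δ sy → Vars Δ sw → Fm Δ
    ΦAt a b c = ren (λ v → lookupV (a ++ᵥ b ++ᵥ c) (ρ v)) Φ

Theorem711 : Signature → Set
Theorem711 S =
  ∀ {Γ sx sw : List Sort} (x : Vars Γ sx) (w : Vars Γ sw) (sy sz : List Sort)
    {Θ : List Sort} (Φ : Fm Θ) (ρ : Ren Θ (sx ++ sy ++ sw)) →
    Γ ⨾ [] ⊢ schema711 x w sy sz Φ ρ
  where
  open Signature S
  open Logic S

-- Choose y⃗ with Φ(x⃗,y⃗,w⃗).  The independence principle (I7), applied to y⃗ over the
-- condition x⃗,w⃗, yields a copy y⃗′ with y⃗′,x⃗,w⃗ ∼ y⃗,x⃗,w⃗ and y⃗′ ⊥ z⃗ ∣ x⃗,w⃗.  Invariance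
-- (E6, after reordering the blocks with E4) transfers Φ from y⃗ to y⃗′, and contraction
-- (I6, with symmetry I3 and permutation I1) combines y⃗′ ⊥ z⃗ ∣ x⃗,w⃗ with x⃗ ⊥ z⃗ ∣ w⃗ into
-- x⃗,y⃗′ ⊥ z⃗ ∣ w⃗.

module Submission where

open import Defs
open import Data.List using (List; []; _∷_; _++_; map)
open import Data.List.Properties using (map-id; map-cong; map-∘)
open import Data.List.Relation.Unary.All using ([]; _∷_)
import Data.List.Relation.Unary.All.Properties as All
open import Data.List.Relation.Unary.Any using (here; there)
open import Data.List.Relation.Binary.Permutation.Propositional using (_↭_)
import Data.List.Relation.Binary.Permutation.Propositional as ↭
open import Data.List.Relation.Binary.Subset.Propositional using (_⊆_)
open import Data.List.Relation.Binary.Subset.Propositional.Properties using (∷⁺ʳ; map⁺; ⊆-reflexive)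
open import Relation.Binary.PropositionalEquality using (_≡_; refl; sym; trans; cong; cong₂; subst; subst₂;
  module ≡-Reasoning)

module Derivations (S : Signature) where
  open Signature S
  open Logic S

  cong-ind : ∀ {Γ sx sy sz} {a a' : Vars Γ sx} {b b' : Vars Γ sy} {c c' : Vars Γ sz} →
             a ≡ a' → b ≡ b' → c ≡ c' → ind a b c ≡ ind a' b' c'
  cong-ind refl refl refl = refl

  renV-fusion : ∀ {Γ Δ E ss} {ρ : Ren Δ E} {σ : Ren Γ Δ} {τ : Ren Γ E} →
                (∀ {s} (v : Γ ∋ s) → ρ (σ v) ≡ τ v) →
                (xs : Vars Γ ss) → renV ρ (renV σ xs) ≡ renV τ xs
  renV-fusion h xs = trans (All.map-∘ xs) (All.map-cong xs h)

  lift-fusion : ∀ {Γ Δ E t} {ρ : Ren Δ E} {σ : Ren Γ Δ} {τ : Ren Γ E} →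
                (∀ {s} (v : Γ ∋ s) → ρ (σ v) ≡ τ v) →
                ∀ {s} (v : (t ∷ Γ) ∋ s) → lift ρ (lift σ v) ≡ lift τ v
  lift-fusion h here = refl
  lift-fusion h (there v) = cong there (h v)

  ren-fusion : ∀ {Γ Δ E} {ρ : Ren Δ E} {σ : Ren Γ Δ} {τ : Ren Γ E} →
               (∀ {s} (v : Γ ∋ s) → ρ (σ v) ≡ τ v) →
               (φ : Fm Γ) → ren ρ (ren σ φ) ≡ ren τ φ
  ren-fusion h (rel R xs) = cong (rel R) (renV-fusion h xs)
  ren-fusion h (eq u v) = cong₂ eq (h u) (h v)
  ren-fusion h (sim xs ys) = cong₂ sim (renV-fusion h xs) (renV-fusion h ys)
  ren-fusion h (ind xs ys zs) = cong-ind (renV-fusion h xs) (renV-fusion h ys) (renV-fusion h zs)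
  ren-fusion h ⊥' = refl
  ren-fusion h (φ ⇒ ψ) = cong₂ _⇒_ (ren-fusion h φ) (ren-fusion h ψ)
  ren-fusion h (φ ∧' ψ) = cong₂ _∧'_ (ren-fusion h φ) (ren-fusion h ψ)
  ren-fusion h (φ ∨' ψ) = cong₂ _∨'_ (ren-fusion h φ) (ren-fusion h ψ)
  ren-fusion h (∀' s φ) = cong (∀' s) (ren-fusion (lift-fusion h) φ)
  ren-fusion h (∃' s φ) = cong (∃' s) (ren-fusion (lift-fusion h) φ)

  renV-id : ∀ {Γ ss} {ρ : Ren Γ Γ} → (∀ {s} (v : Γ ∋ s) → ρ v ≡ v) →
            (xs : Vars Γ ss) → renV ρ xs ≡ xs
  renV-id h xs = trans (All.map-cong xs h) (All.map-id xs)

  lift-id : ∀ {Γ t} {ρ : Ren Γ Γ} → (∀ {s} (v : Γ ∋ s) → ρ v ≡ v) →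
            ∀ {s} (v : (t ∷ Γ) ∋ s) → lift ρ v ≡ v
  lift-id h here = refl
  lift-id h (there v) = cong there (h v)

  ren-id : ∀ {Γ} {ρ : Ren Γ Γ} → (∀ {s} (v : Γ ∋ s) → ρ v ≡ v) →
           (φ : Fm Γ) → ren ρ φ ≡ φ
  ren-id h (rel R xs) = cong (rel R) (renV-id h xs)
  ren-id h (eq u v) = cong₂ eq (h u) (h v)
  ren-id h (sim xs ys) = cong₂ sim (renV-id h xs) (renV-id h ys)
  ren-id h (ind xs ys zs) = cong-ind (renV-id h xs) (renV-id h ys) (renV-id h zs)
  ren-id h ⊥' = refl
  ren-id h (φ ⇒ ψ) = cong₂ _⇒_ (ren-id h φ) (ren-id h ψ)
  ren-id h (φ ∧' ψ) = cong₂ _∧'_ (ren-id h φ) (ren-id h ψ)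
  ren-id h (φ ∨' ψ) = cong₂ _∨'_ (ren-id h φ) (ren-id h ψ)
  ren-id h (∀' s φ) = cong (∀' s) (ren-id (lift-id h) φ)
  ren-id h (∃' s φ) = cong (∃' s) (ren-id (lift-id h) φ)

  renV-++ : ∀ {Γ Δ ss ts} (f : Ren Γ Δ) (a : Vars Γ ss) (b : Vars Γ ts) →
            renV f (a ++ᵥ b) ≡ renV f a ++ᵥ renV f b
  renV-++ f [] b = refl
  renV-++ f (u ∷ a) b = cong (f u ∷_) (renV-++ f a b)

  lookup-renV : ∀ {Γ Δ ss s} (f : Ren Γ Δ) (a : Vars Γ ss) (i : ss ∋ s) →
                lookupV (renV f a) i ≡ f (lookupV a i)
  lookup-renV f (u ∷ a) here = refl
  lookup-renV f (u ∷ a) (there i) = lookup-renV f a i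

  map-ren-id : ∀ {Γ} (Δ : List (Fm Γ)) → map (ren (inr [])) Δ ≡ Δ
  map-ren-id Δ = trans (map-cong (ren-id λ _ → refl) Δ) (map-id Δ)

  map-ren-inr-∷ : ∀ {Γ} s ss (Δ : List (Fm Γ)) →
                  map (ren (inr (s ∷ ss))) Δ ≡ map wk (map (ren (inr ss)) Δ)
  map-ren-inr-∷ s ss Δ = trans (map-cong (λ φ → sym (ren-fusion (λ _ → refl) φ)) Δ) (map-∘ Δ)

  liftN : ∀ {Γ Δ} ss → Ren Γ Δ → Ren (ss ++ Γ) (ss ++ Δ)
  liftN [] ρ = ρ
  liftN (s ∷ ss) ρ = lift (liftN ss ρ)

  instN : ∀ {Γ ss} → Vars Γ ss → Ren (ss ++ Γ) Γ
  instN [] v = v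
  instN (u ∷ us) here = u
  instN (u ∷ us) (there v) = instN us v

  liftN-inr : ∀ {Γ Δ} ss (f : Ren Γ Δ) {s} (v : Γ ∋ s) → liftN ss f (inr ss v) ≡ inr ss (f v)
  liftN-inr [] f v = refl
  liftN-inr (s ∷ ss) f v = cong there (liftN-inr ss f v)

  instN-inr : ∀ {Γ ss} (vs : Vars Γ ss) {s} (v : Γ ∋ s) → instN vs (inr ss v) ≡ v
  instN-inr [] v = refl
  instN-inr (u ∷ us) v = instN-inr us v

  renV-liftN-inr : ∀ {Γ Δ ts} ss (f : Ren Γ Δ) (a : Vars Γ ts) →
                   renV (liftN ss f) (renV (inr ss) a) ≡ renV (inr ss) (renV f a)
  renV-liftN-inr ss f a = trans (renV-fusion (liftN-inr ss f) a) (sym (renV-fusion (λ _ → refl) a))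

  renV-instN-inr : ∀ {Γ ss ts} (vs : Vars Γ ss) (a : Vars Γ ts) →
                   renV (instN vs) (renV (inr ss) a) ≡ a
  renV-instN-inr vs a = trans (renV-fusion (instN-inr vs) a) (All.map-id a)

  renV-liftN-firstVars : ∀ {Γ Δ} ss (f : Ren Γ Δ) → renV (liftN ss f) (firstVars ss) ≡ firstVars ss
  renV-liftN-firstVars [] f = refl
  renV-liftN-firstVars (s ∷ ss) f = cong (here ∷_) (begin
    renV (lift (liftN ss f)) (renV there (firstVars ss)) ≡⟨ renV-fusion (λ _ → refl) (firstVars ss) ⟩
    renV (λ v → there (liftN ss f v)) (firstVars ss)     ≡⟨ renV-fusion (λ _ → refl) (firstVars ss) ⟨
    renV there (renV (liftN ss f) (firstVars ss))        ≡⟨ cong (renV there) (renV-liftN-firstVars ss f) ⟩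
    renV there (firstVars ss)                            ∎)
    where open ≡-Reasoning

  renV-instN-firstVars : ∀ {Γ ss} (vs : Vars Γ ss) → renV (instN vs) (firstVars ss) ≡ vs
  renV-instN-firstVars [] = refl
  renV-instN-firstVars (u ∷ us) =
    cong (u ∷_) (trans (renV-fusion (λ _ → refl) (firstVars _)) (renV-instN-firstVars us))

  ren-∃* : ∀ {Γ Δ} ss (f : Ren Γ Δ) (φ : Fm (ss ++ Γ)) →
           ren f (∃* ss φ) ≡ ∃* ss (ren (liftN ss f) φ)
  ren-∃* [] f φ = refl
  ren-∃* (s ∷ ss) f φ = ren-∃* ss f (∃' s φ)

  ⊢-cast : ∀ {Γ Δ φ ψ} → φ ≡ ψ → Γ ⨾ Δ ⊢ φ → Γ ⨾ Δ ⊢ ψ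
  ⊢-cast refl d = d

  weaken : ∀ {Γ Δ Δ' φ} → Δ ⊆ Δ' → Γ ⨾ Δ ⊢ φ → Γ ⨾ Δ' ⊢ φ
  weaken h (hyp p) = hyp (h p)
  weaken h (ax a) = ax a
  weaken h (raa d) = raa (weaken (∷⁺ʳ _ h) d)
  weaken h (⇒I d) = ⇒I (weaken (∷⁺ʳ _ h) d)
  weaken h (⇒E d e) = ⇒E (weaken h d) (weaken h e)
  weaken h (∧I d e) = ∧I (weaken h d) (weaken h e)
  weaken h (∧E₁ d) = ∧E₁ (weaken h d)
  weaken h (∧E₂ d) = ∧E₂ (weaken h d)
  weaken h (∨I₁ d) = ∨I₁ (weaken h d)
  weaken h (∨I₂ d) = ∨I₂ (weaken h d)
  weaken h (∨E d e f) = ∨E (weaken h d) (weaken (∷⁺ʳ _ h) e) (weaken (∷⁺ʳ _ h) f)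
  weaken h (∀I d) = ∀I (weaken (map⁺ wk h) d)
  weaken h (∀E d v) = ∀E (weaken h d) v
  weaken h (∃I v d) = ∃I v (weaken h d)
  weaken h (∃E d e) = ∃E (weaken h d) (weaken (∷⁺ʳ _ (map⁺ wk h)) e)
  weaken h (eqR v) = eqR v
  weaken h (eqS d e) = eqS (weaken h d) (weaken h e)
  weaken h (nonempty d) = nonempty (weaken (map⁺ wk h) d)

  ∀*I : ∀ {Γ} ss {Δ φ} → (ss ++ Γ) ⨾ map (ren (inr ss)) Δ ⊢ φ → Γ ⨾ Δ ⊢ ∀* ss φ
  ∀*I [] {Δ} d = subst (_ ⨾_⊢ _) (map-ren-id Δ) d
  ∀*I (s ∷ ss) {Δ} d = ∀*I ss (∀I (subst (_ ⨾_⊢ _) (map-ren-inr-∷ s ss Δ) d))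

  ∃*I : ∀ {Γ ss Δ φ} (vs : Vars Γ ss) → Γ ⨾ Δ ⊢ ren (instN vs) φ → Γ ⨾ Δ ⊢ ∃* ss φ
  ∃*I [] d = ⊢-cast (ren-id (λ _ → refl) _) d
  ∃*I {φ = φ} (u ∷ us) d = ∃*I us (∃I u (⊢-cast (sym (ren-fusion inst-lift φ)) d))
    where
    inst-lift : ∀ {s} (v : _ ∋ s) → inst u (lift (instN us) v) ≡ instN (u ∷ us) v
    inst-lift here = refl
    inst-lift (there v) = refl

  ∃*E : ∀ {Γ} ss {Δ φ ψ} → Γ ⨾ Δ ⊢ ∃* ss φ →
        (ss ++ Γ) ⨾ φ ∷ map (ren (inr ss)) Δ ⊢ ren (inr ss) ψ → Γ ⨾ Δ ⊢ ψ
  ∃*E [] {Δ} {φ} {ψ} d e =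
    ⇒E (⇒I (subst₂ (λ H χ → _ ⨾ φ ∷ H ⊢ χ) (map-ren-id Δ) (ren-id (λ _ → refl) ψ) e)) d
  ∃*E (s ∷ ss) {Δ} {φ} {ψ} d e =
    ∃*E ss d (∃E (hyp (here refl)) (⊢-cast (sym (ren-fusion (λ _ → refl) ψ)) (weaken drop-∃ e)))
    where
    drop-∃ : φ ∷ map (ren (inr (s ∷ ss))) Δ ⊆ φ ∷ wk (∃' s φ) ∷ map wk (map (ren (inr ss)) Δ)
    drop-∃ = ∷⁺ʳ φ (λ p → there (⊆-reflexive (map-ren-inr-∷ s ss Δ) p))

  ↭-insert : ∀ (s : Sort) ts us → (s ∷ ts ++ us) ↭ (ts ++ s ∷ us)
  ↭-insert s [] us = ↭.refl
  ↭-insert s (t ∷ ts) us = ↭.trans (↭.swap s t ↭.refl) (↭.prep t (↭-insert s ts us))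

  perm-insert : ∀ {Γ s ts us} (u : Γ ∋ s) (b : Vars Γ ts) (c : Vars Γ us) →
                perm (↭-insert s ts us) (u ∷ b ++ᵥ c) ≡ b ++ᵥ u ∷ c
  perm-insert u [] c = refl
  perm-insert u (v ∷ b) c = cong (v ∷_) (perm-insert u b c)

  ↭-swap-++ : ∀ (ss ts us : List Sort) → (ss ++ ts ++ us) ↭ (ts ++ ss ++ us)
  ↭-swap-++ [] ts us = ↭.refl
  ↭-swap-++ (s ∷ ss) ts us = ↭.trans (↭.prep s (↭-swap-++ ss ts us)) (↭-insert s ts (ss ++ us))

  perm-swap-++ : ∀ {Γ ss ts us} (a : Vars Γ ss) (b : Vars Γ ts) (c : Vars Γ us) →
                 perm (↭-swap-++ ss ts us) (a ++ᵥ b ++ᵥ c) ≡ b ++ᵥ a ++ᵥ c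
  perm-swap-++ [] b c = refl
  perm-swap-++ {ts = ts} {us} (u ∷ a) b c =
    trans (cong (λ v → perm (↭-insert _ ts (_ ++ us)) (u ∷ v)) (perm-swap-++ a b c))
          (perm-insert u b (a ++ᵥ c))

  ↭-++-[] : ∀ (ts : List Sort) → ts ↭ (ts ++ [])
  ↭-++-[] [] = ↭.refl
  ↭-++-[] (t ∷ ts) = ↭.prep t (↭-++-[] ts)

  perm-++-[] : ∀ {Γ ts} (b : Vars Γ ts) → perm (↭-++-[] ts) b ≡ b ++ᵥ []
  perm-++-[] [] = refl
  perm-++-[] (u ∷ b) = cong (u ∷_) (perm-++-[] b)

  ↭-++-comm : ∀ (ss ts : List Sort) → (ss ++ ts) ↭ (ts ++ ss)
  ↭-++-comm [] ts = ↭-++-[] ts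
  ↭-++-comm (s ∷ ss) ts = ↭.trans (↭.prep s (↭-++-comm ss ts)) (↭-insert s ts ss)

  perm-++-comm : ∀ {Γ ss ts} (a : Vars Γ ss) (b : Vars Γ ts) →
                 perm (↭-++-comm ss ts) (a ++ᵥ b) ≡ b ++ᵥ a
  perm-++-comm [] b = perm-++-[] b
  perm-++-comm {ss = s ∷ ss} {ts} (u ∷ a) b =
    trans (cong (λ v → perm (↭-insert s ts ss) (u ∷ v)) (perm-++-comm a b)) (perm-insert u b a)

  sim-swap-++ : ∀ {Γ Δ ss ts us} {a a' : Vars Γ ss} {b b' : Vars Γ ts} {c c' : Vars Γ us} →
                Γ ⨾ Δ ⊢ sim (b ++ᵥ a ++ᵥ c) (b' ++ᵥ a' ++ᵥ c') →
                Γ ⨾ Δ ⊢ sim (a ++ᵥ b ++ᵥ c) (a' ++ᵥ b' ++ᵥ c')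
  sim-swap-++ {ss = ss} {ts} {us} {a} {a'} {b} {b'} {c} {c'} d =
    subst₂ (λ u v → _ ⨾ _ ⊢ sim u v) (perm-swap-++ b a c) (perm-swap-++ b' a' c')
      (⇒E (ax (E4 (↭-swap-++ ts ss us) _ _)) d)

  ind-contraction : ∀ {Γ Δ sx sy sz sw} {x : Vars Γ sx} {y : Vars Γ sy} {z : Vars Γ sz} {w : Vars Γ sw} →
                    Γ ⨾ Δ ⊢ ind y z (x ++ᵥ w) → Γ ⨾ Δ ⊢ ind x z w → Γ ⨾ Δ ⊢ ind (x ++ᵥ y) z w
  ind-contraction {Γ} {Δ} {sx} {sy} {x = x} {y} {z} {w} y⊥z∣xw x⊥z∣w =
    subst (λ v → _ ⨾ _ ⊢ ind v z w) (perm-++-comm y x)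
      (⇒E (ax (I1 (↭-++-comm sy sx) ↭.refl ↭.refl _ z w))
        (ind-sym (⇒E (ax (I6 z y x w)) (∧I (ind-sym y⊥z∣xw) (ind-sym x⊥z∣w)))))
    where
    ind-sym : ∀ {sa sb sc} {a : Vars Γ sa} {b : Vars Γ sb} {c : Vars Γ sc} →
           Γ ⨾ Δ ⊢ ind a b c → Γ ⨾ Δ ⊢ ind b a c
    ind-sym = ⇒E (ax (I3 _ _ _))

  module Extension {sx sy sw Θ} (Φ : Fm Θ) (ρ : Ren Θ (sx ++ sy ++ sw)) where

    -- As in schema711, so that the formulas of the theorem are literally these.
    Φ[_,_,_] : ∀ {Δ} → Vars Δ sx → Vars Δ sy → Vars Δ sw → Fm Δ
    Φ[ a , b , c ] = ren (λ v → lookupV (a ++ᵥ b ++ᵥ c) (ρ v)) Φ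

    Ψ[_,_,_,_] : ∀ {Δ sz} → Vars Δ sx → Vars Δ sy → Vars Δ sz → Vars Δ sw → Fm Δ
    Ψ[ a , b , c , d ] = ind (a ++ᵥ b) c d ∧' Φ[ a , b , d ]

    ⇑ : ∀ {Δ ts} → Vars Δ ts → Vars (sy ++ Δ) ts
    ⇑ = renV (inr sy)

    ren-Φ : ∀ {Δ E} (f : Ren Δ E) {a a' b b' c c'} →
            renV f a ≡ a' → renV f b ≡ b' → renV f c ≡ c' → ren f Φ[ a , b , c ] ≡ Φ[ a' , b' , c' ]
    ren-Φ f {a} {b = b} {c = c} refl refl refl = ren-fusion lookup-f Φ
      where
      lookup-f : ∀ {s} (v : Θ ∋ s) →
                 f (lookupV (a ++ᵥ b ++ᵥ c) (ρ v)) ≡ lookupV (renV f a ++ᵥ renV f b ++ᵥ renV f c) (ρ v)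
      lookup-f v = trans (sym (lookup-renV f (a ++ᵥ b ++ᵥ c) (ρ v)))
        (cong (λ V → lookupV V (ρ v)) (trans (renV-++ f a (b ++ᵥ c)) (cong (renV f a ++ᵥ_) (renV-++ f b c))))

    ren-Ψ : ∀ {Δ E sz} (f : Ren Δ E) {a a' b b'} {c : Vars Δ sz} {c' : Vars E sz} {d d'} →
            renV f a ≡ a' → renV f b ≡ b' → renV f c ≡ c' → renV f d ≡ d' →
            ren f Ψ[ a , b , c , d ] ≡ Ψ[ a' , b' , c' , d' ]
    ren-Ψ f {a} {b = b} {d = d} refl refl refl refl =
      cong₂ _∧'_ (cong-ind (renV-++ f a b) refl refl) (ren-Φ f {a} {b = b} {c = d} refl refl refl)

    ren-∃Φ : ∀ {Δ E} (f : Ren Δ E) (a : Vars Δ sx) (c : Vars Δ sw) →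
             ren f (∃* sy Φ[ ⇑ a , firstVars sy , ⇑ c ]) ≡ ∃* sy Φ[ ⇑ (renV f a) , firstVars sy , ⇑ (renV f c) ]
    ren-∃Φ f a c = trans (ren-∃* sy f _) (cong (∃* sy) (ren-Φ (liftN sy f)
      (renV-liftN-inr sy f a) (renV-liftN-firstVars sy f) (renV-liftN-inr sy f c)))

    ren-∃Ψ : ∀ {Δ E sz} (f : Ren Δ E) (a : Vars Δ sx) (c : Vars Δ sz) (d : Vars Δ sw) →
             ren f (∃* sy Ψ[ ⇑ a , firstVars sy , ⇑ c , ⇑ d ])
             ≡ ∃* sy Ψ[ ⇑ (renV f a) , firstVars sy , ⇑ (renV f c) , ⇑ (renV f d) ]
    ren-∃Ψ f a c d = trans (ren-∃* sy f _) (cong (∃* sy) (ren-Ψ (liftN sy f)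
      (renV-liftN-inr sy f a) (renV-liftN-firstVars sy f) (renV-liftN-inr sy f c) (renV-liftN-inr sy f d)))

    ∃Ψ-intro : ∀ {Δ D sz} {a : Vars Δ sx} {c : Vars Δ sz} {d : Vars Δ sw} (b : Vars Δ sy) →
               Δ ⨾ D ⊢ Ψ[ a , b , c , d ] → Δ ⨾ D ⊢ ∃* sy Ψ[ ⇑ a , firstVars sy , ⇑ c , ⇑ d ]
    ∃Ψ-intro {a = a} {c} {d} b p = ∃*I b (⊢-cast (sym (ren-Ψ (instN b)
      (renV-instN-inr b a) (renV-instN-firstVars b) (renV-instN-inr b c) (renV-instN-inr b d))) p)

    Φ-transfer : ∀ {Δ D} {a : Vars Δ sx} {b b' : Vars Δ sy} {c : Vars Δ sw} →
                 Δ ⨾ D ⊢ sim (b' ++ᵥ a ++ᵥ c) (b ++ᵥ a ++ᵥ c) →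
                 Δ ⨾ D ⊢ Φ[ a , b , c ] → Δ ⨾ D ⊢ Φ[ a , b' , c ]
    Φ-transfer {a = a} {b} {b'} {c} b'a∼ba p =
      ⊢-cast (E6-instance b')
        (⇒E (ax (E6 (a ++ᵥ b ++ᵥ c) (a ++ᵥ b' ++ᵥ c) (ren ρ Φ)))
          (∧I (sim-swap-++ {a = a} {a} {b} {b'} {c} {c} (⇒E (ax (E2 _ _)) b'a∼ba))
              (⊢-cast (sym (E6-instance b)) p)))
      where
      E6-instance : ∀ b₀ → ren (lookupV (a ++ᵥ b₀ ++ᵥ c)) (ren ρ Φ) ≡ Φ[ a , b₀ , c ]
      E6-instance b₀ = ren-fusion (λ _ → refl) Φ

    -- x⃗ ⊥ z⃗ ∣ w⃗ is made a hypothesis so that it is carried along under the quantifiers.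
    independent-witness : ∀ {Δ D sz} {x : Vars Δ sx} {z : Vars Δ sz} {w : Vars Δ sw} →
                          Δ ⨾ D ⊢ ∃* sy Φ[ ⇑ x , firstVars sy , ⇑ w ] → Δ ⨾ D ⊢ ind x z w →
                          Δ ⨾ D ⊢ ∃* sy Ψ[ ⇑ x , firstVars sy , ⇑ z , ⇑ w ]
    independent-witness {Δ} {D} {sz} {x} {z} {w} ∃y x⊥z∣w =
      ⇒E (⇒I (∃*E sy (weaken there ∃y) choose-y)) x⊥z∣w
      where
      choose-y : (sy ++ Δ) ⨾ Φ[ ⇑ x , firstVars sy , ⇑ w ] ∷ map (ren (inr sy)) (ind x z w ∷ D)
                 ⊢ ren (inr sy) (∃* sy Ψ[ ⇑ x , firstVars sy , ⇑ z , ⇑ w ])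
      choose-y = ⊢-cast (sym (ren-∃Ψ (inr sy) x z w))
        (∃*E sy (ax (I7 (firstVars sy) (⇑ z) (⇑ x ++ᵥ ⇑ w))) choose-copy)
        where
        Ω : List Sort
        Ω = sy ++ sy ++ Δ

        x₂ : Vars Ω sx
        x₂ = ⇑ (⇑ x)
        y₂ y' : Vars Ω sy
        y₂ = ⇑ (firstVars sy)
        y' = firstVars sy
        z₂ : Vars Ω sz
        z₂ = ⇑ (⇑ z)
        w₂ : Vars Ω sw
        w₂ = ⇑ (⇑ w)

        copy : Fm Ω
        copy = sim (y' ++ᵥ ⇑ (⇑ x ++ᵥ ⇑ w)) (y₂ ++ᵥ ⇑ (⇑ x ++ᵥ ⇑ w)) ∧' ind y' z₂ (⇑ (⇑ x ++ᵥ ⇑ w))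

        Hyps : List (Fm Ω)
        Hyps = copy ∷ map (ren (inr sy)) (Φ[ ⇑ x , firstVars sy , ⇑ w ] ∷ map (ren (inr sy)) (ind x z w ∷ D))

        y'∼y : Ω ⨾ Hyps ⊢ sim (y' ++ᵥ x₂ ++ᵥ w₂) (y₂ ++ᵥ x₂ ++ᵥ w₂)
        y'∼y = subst (λ V → Ω ⨾ Hyps ⊢ sim (y' ++ᵥ V) (y₂ ++ᵥ V))
                     (renV-++ (inr sy) (⇑ x) (⇑ w)) (∧E₁ (hyp (here refl)))

        y'⊥z∣xw : Ω ⨾ Hyps ⊢ ind y' z₂ (x₂ ++ᵥ w₂)
        y'⊥z∣xw = subst (λ V → Ω ⨾ Hyps ⊢ ind y' z₂ V)
                        (renV-++ (inr sy) (⇑ x) (⇑ w)) (∧E₂ (hyp (here refl)))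

        Φxyw : Ω ⨾ Hyps ⊢ Φ[ x₂ , y₂ , w₂ ]
        Φxyw = ⊢-cast (ren-Φ (inr sy) {⇑ x} {b = firstVars sy} {c = ⇑ w} refl refl refl)
                      (hyp (there (here refl)))

        Φxy'w : Ω ⨾ Hyps ⊢ Φ[ x₂ , y' , w₂ ]
        Φxy'w = Φ-transfer {a = x₂} {y₂} {c = w₂} y'∼y Φxyw

        x₂⊥z₂∣w₂ : Ω ⨾ Hyps ⊢ ind x₂ z₂ w₂
        x₂⊥z₂∣w₂ = hyp (there (there (here refl)))

        choose-copy : Ω ⨾ Hyps ⊢ ren (inr sy) (∃* sy Ψ[ ⇑ (⇑ x) , firstVars sy , ⇑ (⇑ z) , ⇑ (⇑ w) ])
        choose-copy = ⊢-cast (sym (ren-∃Ψ (inr sy) (⇑ x) (⇑ z) (⇑ w)))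
          (∃Ψ-intro y' (∧I (ind-contraction y'⊥z∣xw x₂⊥z₂∣w₂) Φxy'w))

  theorem711 : Theorem711 S
  theorem711 {sx = sx} {sw} x w sy sz Φ ρ =
    ⇒I (∀*I sz (⇒I (independent-witness
      (⊢-cast (ren-∃Φ (inr sz) x w) (hyp (there (here refl))))
      (hyp (here refl)))))
    where open Extension {sx} {sy} {sw} Φ ρ

theorem7p11 : (S : Signature) → Theorem711 S
theorem7p11 = Derivations.theorem711
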